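{- The complement of a proper LDDG is a proper LDDG.
   Context: Graphs here are finite, undirected, without multiple edges, but loops are allowed: a vertex may be adjacent to itself. For a vertex $x$, $\Gamma(x)$ is the set of vertices adjacent to $x$ (containing $x$ iff $x$ has a loop), and the degree of $x$ is $|\Gamma(x)|$ (a loop contributes exactly 1). Common neighbours of $x,y$ are the elements of $\Gamma(x)\cap\Gamma(y)$. The complement $\overline{\Gamma}$ of $\Gamma$ has the same vertex set, and two possibly equal vertices are adjacent in $\overline{\Gamma}$ iff they are not adjacent in $\Gamma$ (so a vertex has a loop in $\overline{\Gamma}$ iff it has none in $\Gamma$). A $k$-regular graph on $v$ vertices is an LDDG with parameters $(v,k,\lambda_1,\lambda_2,m,n)$ if its vertex set can be partitioned into $m$ classes of size $n$ such that any two distinct vertices of the same class have exactly $\lambda_1$ common neighbours and any two vertices of different classes have exactly $\lambda_2$ common neighbours. It is proper if $m,n\geq 2$ and $\lambda_1\neq\lambda_2$. -}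

module Defs where

open import Data.Nat using (ℕ; zero; suc; _+_; _≤_)
open import Data.Fin using (Fin)
import Data.Fin as F
open import Data.Bool using (Bool; true; false; _∧_; not; if_then_else_)
open import Data.Product using (Σ; _×_; _,_)
open import Relation.Binary.PropositionalEquality using (_≡_; _≢_)
open import Relation.Nullary using (¬_; Dec; does)
open import Data.Fin.Properties using () renaming (_≟_ to _≟ᶠ_)

count : ∀ {v} → (Fin v → Bool) → ℕ
count {zero}  p = 0
count {suc v} p = (if p F.zero then 1 else 0) + count {v} (λ i → p (F.suc i))

-- A finite undirected graph without multiple edges, loops allowed,
-- on vertex set Fin v: a symmetric Boolean adjacency relation.
-- adj x x ≡ true means x carries a loop.
record Graph (v : ℕ) : Set where
  field
    adj : Fin v → Fin v → Bool
    sym : ∀ x y → adj x y ≡ adj y x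
open Graph public

-- degree |Γ(x)| (a loop contributes 1)
degree : ∀ {v} → Graph v → Fin v → ℕ
degree G x = count (λ z → adj G x z)

common : ∀ {v} → Graph v → Fin v → Fin v → ℕ
common G x y = count (λ z → adj G x z ∧ adj G y z)

-- complement: x ~ y in the complement iff not x ~ y in G (also for x = y)
complement : ∀ {v} → Graph v → Graph v
complement G = record { adj = λ x y → not (adj G x y)
                      ; sym = λ x y → Eq.cong not (sym G x y) }
  where import Relation.Binary.PropositionalEquality as Eq

Regular : ∀ {v} → Graph v → ℕ → Set
Regular G k = ∀ x → degree G x ≡ k

record IsLDDG {v : ℕ} (G : Graph v) (k λ₁ λ₂ m n : ℕ) : Set where
  field
    regular    : Regular G k
    cls        : Fin v → Fin m
    classSize  : ∀ (c : Fin m) → count (λ x → does (cls x ≟ᶠ c)) ≡ n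
    sameClass  : ∀ x y → x ≢ y → cls x ≡ cls y → common G x y ≡ λ₁
    diffClass  : ∀ x y → cls x ≢ cls y → common G x y ≡ λ₂

IsProperLDDG : ∀ {v} → Graph v → ℕ → ℕ → ℕ → ℕ → ℕ → Set
IsProperLDDG G k λ₁ λ₂ m n =
  IsLDDG G k λ₁ λ₂ m n × 2 ≤ m × 2 ≤ n × λ₁ ≢ λ₂

ProperLDDG : ∀ {v} → Graph v → Set
ProperLDDG G = Σ ℕ λ k → Σ ℕ λ λ₁ → Σ ℕ λ λ₂ → Σ ℕ λ m → Σ ℕ λ n →
  IsProperLDDG G k λ₁ λ₂ m n

-- In the complement every vertex has degree v − k, and by inclusion–exclusion two vertices
-- x, y of a k-regular graph have v − 2k + |Γ(x) ∩ Γ(y)| common non-neighbours. So the same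
-- partition makes the complement an LDDG with λ̄ᵢ = v − 2k + λᵢ, and λ̄₁ ≠ λ̄₂ because both
-- values are attained by actual pairs of vertices, which exist once m, n ≥ 2.
module Submission where

open import Defs
open import Data.Nat using (ℕ; zero; suc; _+_; _∸_; _≤_; s≤s)
open import Data.Nat.Properties
  using (m+n∸n≡m; +-assoc; +-cancelˡ-≡; ≤-pred; <⇒≤; +-commutativeSemigroup)
open import Algebra.Properties.CommutativeSemigroup +-commutativeSemigroup
  using (interchange; x∙yz≈y∙xz)
open import Data.Fin using (Fin)
import Data.Fin as F
open import Data.Fin.Properties using (0≢1+n; suc-injective) renaming (_≟_ to _≟ᶠ_)
open import Data.Bool using (Bool; true; false; _∧_; not; if_then_else_; T)
open import Data.Product using (∃; ∃₂; _×_; _,_)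
open import Data.Unit using (tt)
open import Relation.Binary.PropositionalEquality
  using (_≡_; _≢_; refl; trans; cong; cong₂; subst; module ≡-Reasoning)
  renaming (sym to ≡-sym)
open import Relation.Nullary using (Dec; yes; does)
open ≡-Reasoning

m+n≡o⇒m≡o∸n : ∀ {m n o} → m + n ≡ o → m ≡ o ∸ n
m+n≡o⇒m≡o∸n {m} {n} m+n≡o = trans (≡-sym (m+n∸n≡m m n)) (cong (_∸ n) m+n≡o)

distinct-elements : ∀ {m} → 2 ≤ m → ∃₂ λ (i j : Fin m) → i ≢ j
distinct-elements (s≤s (s≤s _)) = F.zero , F.suc F.zero , 0≢1+n

indicator : Bool → ℕ
indicator b = if b then 1 else 0

count-not : ∀ {v} (p : Fin v → Bool) → count (λ z → not (p z)) + count p ≡ v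
count-not {zero}  p = refl
count-not {suc v} p = begin
  (indicator (not p₀) + count (λ z → not (p' z))) + (indicator p₀ + count p')
    ≡⟨ interchange (indicator (not p₀)) _ (indicator p₀) _ ⟩
  (indicator (not p₀) + indicator p₀) + (count (λ z → not (p' z)) + count p')
    ≡⟨ cong₂ _+_ (indicator-not p₀) (count-not p') ⟩
  suc v ∎
  where
  p₀ = p F.zero
  p' = λ i → p (F.suc i)
  indicator-not : ∀ b → indicator (not b) + indicator b ≡ 1
  indicator-not true  = refl
  indicator-not false = refl

count-inclusion-exclusion : ∀ {v} (a b : Fin v → Bool) →
  count (λ z → not (a z) ∧ not (b z)) + count a + count b ≡ v + count (λ z → a z ∧ b z)
count-inclusion-exclusion {zero}  a b = refl
count-inclusion-exclusion {suc v} a b = begin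
  (indicator (not a₀ ∧ not b₀) + N) + (indicator a₀ + A) + (indicator b₀ + B)
    ≡⟨ cong (_+ (indicator b₀ + B)) (interchange (indicator (not a₀ ∧ not b₀)) N (indicator a₀) A) ⟩
  (indicator (not a₀ ∧ not b₀) + indicator a₀) + (N + A) + (indicator b₀ + B)
    ≡⟨ interchange (indicator (not a₀ ∧ not b₀) + indicator a₀) (N + A) (indicator b₀) B ⟩
  (indicator (not a₀ ∧ not b₀) + indicator a₀ + indicator b₀) + (N + A + B)
    ≡⟨ cong₂ _+_ (indicator-inclusion-exclusion a₀ b₀) (count-inclusion-exclusion a' b') ⟩
  suc (indicator (a₀ ∧ b₀) + (v + C))
    ≡⟨ cong suc (x∙yz≈y∙xz (indicator (a₀ ∧ b₀)) v C) ⟩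
  suc v + (indicator (a₀ ∧ b₀) + C) ∎
  where
  a₀ = a F.zero
  b₀ = b F.zero
  a' = λ i → a (F.suc i)
  b' = λ i → b (F.suc i)
  N = count (λ z → not (a' z) ∧ not (b' z))
  A = count a'
  B = count b'
  C = count (λ z → a' z ∧ b' z)
  indicator-inclusion-exclusion : ∀ x y →
    indicator (not x ∧ not y) + indicator x + indicator y ≡ 1 + indicator (x ∧ y)
  indicator-inclusion-exclusion true  true  = refl
  indicator-inclusion-exclusion true  false = refl
  indicator-inclusion-exclusion false true  = refl
  indicator-inclusion-exclusion false false = refl

count-witness : ∀ {v} (p : Fin v → Bool) → 1 ≤ count p → ∃ λ x → T (p x)
count-witness {suc v} p 1≤count with p F.zero in p₀≡
... | true  = F.zero , subst T (≡-sym p₀≡) tt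
... | false with count-witness (λ i → p (F.suc i)) 1≤count
...   | x , px = F.suc x , px

count-two-witnesses : ∀ {v} (p : Fin v → Bool) → 2 ≤ count p →
  ∃₂ λ x y → x ≢ y × T (p x) × T (p y)
count-two-witnesses {suc v} p 2≤count with p F.zero in p₀≡
... | true with count-witness (λ i → p (F.suc i)) (≤-pred 2≤count)
...   | x , px = F.zero , F.suc x , 0≢1+n , subst T (≡-sym p₀≡) tt , px
count-two-witnesses {suc v} p 2≤count | false
  with count-two-witnesses (λ i → p (F.suc i)) 2≤count
...   | x , y , x≢y , px , py = F.suc x , F.suc y , (λ e → x≢y (suc-injective e)) , px , py

from-does : ∀ {P : Set} (P? : Dec P) → T (does P?) → P
from-does (yes p) _ = p

module _ {v : ℕ} (G : Graph v) where

  degree-complement : ∀ x → degree (complement G) x + degree G x ≡ v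
  degree-complement x = count-not (adj G x)

  common-complement : ∀ x y →
    common (complement G) x y + degree G x + degree G y ≡ v + common G x y
  common-complement x y = count-inclusion-exclusion (adj G x) (adj G y)

module _ {v k λ₁ λ₂ m n} {G : Graph v} (L : IsLDDG G k λ₁ λ₂ m n) where
  open IsLDDG L

  class-member : (c : Fin m) → 1 ≤ n → ∃ λ x → cls x ≡ c
  class-member c 1≤n with count-witness _ (subst (1 ≤_) (≡-sym (classSize c)) 1≤n)
  ... | x , x∈c = x , from-does (cls x ≟ᶠ c) x∈c

  two-class-members : (c : Fin m) → 2 ≤ n → ∃₂ λ x y → x ≢ y × cls x ≡ c × cls y ≡ c
  two-class-members c 2≤n with count-two-witnesses _ (subst (2 ≤_) (≡-sym (classSize c)) 2≤n)
  ... | x , y , x≢y , x∈c , y∈c = x , y , x≢y , from-does (cls x ≟ᶠ c) x∈c , from-does (cls y ≟ᶠ c) y∈c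

  common-complement-regular : ∀ x y → common (complement G) x y + (k + k) ≡ v + common G x y
  common-complement-regular x y = begin
    common (complement G) x y + (k + k)
      ≡⟨ ≡-sym (+-assoc (common (complement G) x y) k k) ⟩
    common (complement G) x y + k + k
      ≡⟨ cong₂ (λ d e → common (complement G) x y + d + e) (≡-sym (regular x)) (≡-sym (regular y)) ⟩
    common (complement G) x y + degree G x + degree G y
      ≡⟨ common-complement G x y ⟩
    v + common G x y ∎

  common-complement-injective : ∀ {x y x' y'} →
    common (complement G) x y ≡ common (complement G) x' y' → common G x y ≡ common G x' y'
  common-complement-injective {x} {y} {x'} {y'} c̄≡c̄' = +-cancelˡ-≡ v _ _ (begin
    v + common G x y                     ≡⟨ ≡-sym (common-complement-regular x y) ⟩
    common (complement G) x y + (k + k)   ≡⟨ cong (_+ (k + k)) c̄≡c̄' ⟩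
    common (complement G) x' y' + (k + k) ≡⟨ common-complement-regular x' y' ⟩
    v + common G x' y' ∎)

  complement-isLDDG :
    IsLDDG (complement G) (v ∸ k) ((v + λ₁) ∸ (k + k)) ((v + λ₂) ∸ (k + k)) m n
  complement-isLDDG = record
    { regular   = λ x → m+n≡o⇒m≡o∸n
        (subst (λ d → degree (complement G) x + d ≡ v) (regular x) (degree-complement G x))
    ; cls       = cls
    ; classSize = classSize
    ; sameClass = λ x y x≢y same → m+n≡o⇒m≡o∸n
        (trans (common-complement-regular x y) (cong (v +_) (sameClass x y x≢y same)))
    ; diffClass = λ x y diff → m+n≡o⇒m≡o∸n
        (trans (common-complement-regular x y) (cong (v +_) (diffClass x y diff)))
    }

  complement-λ-distinct : 2 ≤ m → 2 ≤ n → λ₁ ≢ λ₂ → (v + λ₁) ∸ (k + k) ≢ (v + λ₂) ∸ (k + k)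
  complement-λ-distinct 2≤m 2≤n λ₁≢λ₂ λ̄₁≡λ̄₂ with distinct-elements 2≤m
  ... | i , j , i≢j with two-class-members i 2≤n | class-member j (<⇒≤ 2≤n)
  ... | a , b , a≢b , a∈i , b∈i | c , c∈j = λ₁≢λ₂ (begin
    λ₁           ≡⟨ ≡-sym (sameClass a b a≢b a∼b) ⟩
    common G a b ≡⟨ common-complement-injective (begin
      common (complement G) a b ≡⟨ L̄.sameClass a b a≢b a∼b ⟩
      (v + λ₁) ∸ (k + k)        ≡⟨ λ̄₁≡λ̄₂ ⟩
      (v + λ₂) ∸ (k + k)        ≡⟨ ≡-sym (L̄.diffClass a c a≁c) ⟩
      common (complement G) a c ∎) ⟩
    common G a c ≡⟨ diffClass a c a≁c ⟩
    λ₂ ∎)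
    where
    module L̄ = IsLDDG complement-isLDDG
    a∼b : cls a ≡ cls b
    a∼b = trans a∈i (≡-sym b∈i)
    a≁c : cls a ≢ cls c
    a≁c a∼c = i≢j (trans (≡-sym a∈i) (trans a∼c c∈j))

proposition3p2 : (v : ℕ) (G : Graph v) → ProperLDDG G → ProperLDDG (complement G)
proposition3p2 v G (k , λ₁ , λ₂ , m , n , L , 2≤m , 2≤n , λ₁≢λ₂) =
  v ∸ k , (v + λ₁) ∸ (k + k) , (v + λ₂) ∸ (k + k) , m , n ,
  complement-isLDDG L , 2≤m , 2≤n , complement-λ-distinct L 2≤m 2≤n λ₁≢λ₂
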